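{- There is no non-trivial cycle consisting of a single run; that is, there is no non-trivial cycle $(t_1,\dots,t_m)$ in which exactly one of the terms $t_1,\dots,t_m$ is even.
   Context: The subprime Fibonacci rule: from positive integers $x,y$ with $s=x+y$, the next term is $s$ if $s$ is prime and $s/p$ if $s$ is composite, where $p$ is the smallest prime factor of $s$. A non-trivial cycle of length $m$ is an $m$-tuple $(t_1,\dots,t_m)$ of positive integers, indices read modulo $m$, such that for every $i$, $t_i$ is obtained from $t_{i-2},t_{i-1}$ by this rule, the $t_i$ are not all equal, and $m$ is the minimal period. A cycle is a cyclic concatenation of runs, where a run is a maximal block of consecutive odd terms together with the single even term following it; the number of runs equals the number of even terms in one period. -}

module Defs where

open import Data.Nat using (ℕ; zero; suc; _+_; _*_; _≤_; _<_)
open import Data.Nat.Divisibility using (_∣_)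
open import Data.Nat.Primality using (Prime; Composite)
open import Data.Product using (Σ; _×_; ∃; ∃-syntax)
open import Data.Sum using (_⊎_)
open import Relation.Binary.PropositionalEquality using (_≡_; _≢_)
open import Relation.Nullary using (¬_)

SmallestPrimeFactor : ℕ → ℕ → Set
SmallestPrimeFactor p s = Prime p × p ∣ s × (∀ q → Prime q → q ∣ s → p ≤ q)

SubprimeStep : ℕ → ℕ → ℕ → Set
SubprimeStep x y z =
  (Prime (x + y) × z ≡ x + y)
  ⊎ (Composite (x + y) × ∃[ p ] (SmallestPrimeFactor p (x + y) × z * p ≡ x + y))

-- A non-trivial cycle of length m, represented as an m-periodic sequence
-- t : ℕ → ℕ (t i is the term with index i mod m; t 0 … t (m-1) is one period).
record NontrivialCycle (m : ℕ) (t : ℕ → ℕ) : Set where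
  field
    length-pos : 0 < m
    periodic   : ∀ i → t (i + m) ≡ t i
    positive   : ∀ i → 0 < t i
    rule       : ∀ i → SubprimeStep (t i) (t (suc i)) (t (suc (suc i)))
    notConst   : ∃[ i ] ∃[ j ] (t i ≢ t j)
    minimal    : ∀ d → 0 < d → d < m → ¬ (∀ i → t (i + d) ≡ t i)

ExactlyOneEven : ℕ → (ℕ → ℕ) → Set
ExactlyOneEven m t =
  ∃[ k ] (k < m × 2 ∣ t k × (∀ j → j < m → j ≢ k → ¬ (2 ∣ t j)))

-- Rotate the cycle so that its even term e comes first: u₀ = e, and u₁, …, u_{m-1} are odd.
-- A step from two odd terms has an even sum, whose smallest prime factor is 2, so it takes
-- their average (the only exception, 1, 1 ↦ 2, can only produce the even term); averaging
-- z = (x + y)/2 preserves the weight x + 2y.  Hence with b = u_{m-1} and c, d the terms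
-- after e (which are u₁, u₂ again) we get c + 2d = b + 2e.  The two steps b, e ↦ c and
-- e, c ↦ d have odd sums, so each either copies a prime sum or divides it by a prime ≥ 3.
-- Two copies make c + 2d too big and two divisions make it too small; in the mixed cases
-- the equation forces the divided term to divide the copied prime, hence to be 1, so the
-- divided sum was a prime after all.
module Submission where

open import Defs
open import Data.Nat
open import Data.Nat.Properties
open import Data.Nat.DivMod using (_%_; m%n<n; %-distribˡ-+)
open import Data.Nat.Divisibility
open import Data.Nat.Primality
open import Data.Nat.Tactic.RingSolver using (solve-∀)
open import Data.Product using (_×_; _,_)
open import Data.Sum using (_⊎_; inj₁; inj₂; [_,_]′)
open import Function using (_∘_; _∘′_)
open import Data.Empty using (⊥; ⊥-elim)
open import Relation.Nullary using (¬_; yes; no; contradiction)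
open import Relation.Nullary.Decidable using (toWitness)
open import Relation.Binary.PropositionalEquality

private
  variable
    b c d e m x y z : ℕ

odd⇒%2≡1 : ¬ 2 ∣ x → x % 2 ≡ 1
odd⇒%2≡1 {x} 2∤x with x % 2 in eq | m%n<n x 2
... | 0           | _ = contradiction (m%n≡0⇒n∣m x 2 eq) 2∤x
... | 1           | _ = refl
... | suc (suc _) | s≤s (s≤s ())

odd+odd : ¬ 2 ∣ x → ¬ 2 ∣ y → 2 ∣ x + y
odd+odd {x} {y} 2∤x 2∤y = m%n≡0⇒n∣m (x + y) 2 (begin
  (x + y) % 2           ≡⟨ %-distribˡ-+ x y 2 ⟩
  (x % 2 + y % 2) % 2   ≡⟨ cong₂ (λ r s → (r + s) % 2) (odd⇒%2≡1 2∤x) (odd⇒%2≡1 2∤y) ⟩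
  0                     ∎)
  where open ≡-Reasoning

even+odd : 2 ∣ x → ¬ 2 ∣ y → ¬ 2 ∣ x + y
even+odd 2∣x 2∤y 2∣x+y = 2∤y (∣m+n∣m⇒∣n 2∣x+y 2∣x)

odd+even : ¬ 2 ∣ x → 2 ∣ y → ¬ 2 ∣ x + y
odd+even {x} {y} 2∤x 2∣y 2∣x+y = even+odd 2∣y 2∤x (subst (2 ∣_) (+-comm x y) 2∣x+y)

prime⇒≥2 : ∀ {p} → Prime p → 2 ≤ p
prime⇒≥2 {p} pr = nonTrivial⇒n>1 p {{prime⇒nonTrivial pr}}

prime[3] : Prime 3
prime[3] = toWitness {a? = prime? 3} _

cofactor-of-composite≢1 : ∀ {p n} → Prime p → Composite n → x * p ≡ n → x ≢ 1
cofactor-of-composite≢1 {p = p} pr comp x*p≡n refl =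
  prime⇒¬composite (subst Prime (trans (sym (*-identityˡ p)) x*p≡n) pr) comp

m+n≡2⇒m≡1×n≡1 : 0 < x → 0 < y → x + y ≡ 2 → x ≡ 1 × y ≡ 1
m+n≡2⇒m≡1×n≡1 {1}           {1}           _ _ _  = refl , refl
m+n≡2⇒m≡1×n≡1 {1}           {suc (suc _)} _ _ ()
m+n≡2⇒m≡1×n≡1 {suc (suc x)} {suc _}       _ _ eq = ⊥-elim (m+1+n≢0 x (suc-injective (suc-injective eq)))

subprimeStep-odd-odd : 0 < x → 0 < y → ¬ 2 ∣ x → ¬ 2 ∣ y → SubprimeStep x y z →
                       z * 2 ≡ x + y ⊎ (x ≡ 1 × y ≡ 1 × z ≡ 2)
subprimeStep-odd-odd x>0 y>0 2∤x 2∤y (inj₁ (pr , refl))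
  with prime⇒irreducible pr (odd+odd 2∤x 2∤y)
... | inj₁ ()
... | inj₂ 2≡x+y with m+n≡2⇒m≡1×n≡1 x>0 y>0 (sym 2≡x+y)
...   | x≡1 , y≡1 = inj₂ (x≡1 , y≡1 , sym 2≡x+y)
subprimeStep-odd-odd {z = z} _ _ 2∤x 2∤y (inj₂ (_ , p , (pr , _ , minimal) , z*p≡x+y)) =
  inj₁ (subst (λ q → z * q ≡ _) p≡2 z*p≡x+y)
  where
  p≡2 : p ≡ 2
  p≡2 = ≤-antisym (minimal 2 prime[2] (odd+odd 2∤x 2∤y)) (prime⇒≥2 pr)

data OddSumStep (x y : ℕ) : ℕ → Set where
  prime-sum     : Prime (x + y) → OddSumStep x y (x + y)
  composite-sum : ∀ {p} → Composite (x + y) → Prime p → 3 ≤ p → z * p ≡ x + y → OddSumStep x y z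

subprimeStep-odd-sum : ¬ 2 ∣ x + y → SubprimeStep x y z → OddSumStep x y z
subprimeStep-odd-sum _ (inj₁ (pr , refl)) = prime-sum pr
subprimeStep-odd-sum {x} {y} 2∤x+y (inj₂ (comp , p , (pr , p∣x+y , _) , z*p≡x+y)) =
  composite-sum comp pr (≤∧≢⇒< (prime⇒≥2 pr) 2≢p) z*p≡x+y
  where
  2≢p : 2 ≢ p
  2≢p refl = 2∤x+y p∣x+y

subprimeStep-1-2 : SubprimeStep 1 2 z → z ≡ 3
subprimeStep-1-2 (inj₁ (_ , z≡3))  = z≡3
subprimeStep-1-2 (inj₂ (comp , _))  = contradiction comp (prime⇒¬composite prime[3])

closing-prime-prime : ∀ {b e} → 0 < b → (b + e) + 2 * (e + (b + e)) ≢ b + 2 * e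
closing-prime-prime {suc b} {e} _ eq = <⇒≢ (m<m+n (suc b + 2 * e) z<s) (trans (sym eq) (solve (suc b) e))
  where
  solve : ∀ b e → (b + e) + 2 * (e + (b + e)) ≡ (b + 2 * e) + (2 * b + 3 * e)
  solve = solve-∀

closing-composite-prime : ∀ {b e c p} → 0 < e → Composite (b + e) → Prime p → c * p ≡ b + e →
                          Prime (e + c) → c + 2 * (e + c) ≢ b + 2 * e
closing-composite-prime {b} {e} {c} {p} e>0 comp pr c*p≡b+e pr′ eq =
  [ cofactor-of-composite≢1 pr comp c*p≡b+e , (<⇒≢ (m<n+m c e>0)) ]′
    (prime⇒irreducible pr′ (∣m∣n⇒∣m+n c∣e ∣-refl))
  where
  b≡3c : b ≡ 3 * c
  b≡3c = +-cancelʳ-≡ (2 * e) b (3 * c) (trans (sym eq) (solve c e))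
    where
    solve : ∀ c e → c + 2 * (e + c) ≡ 3 * c + 2 * e
    solve = solve-∀
  c∣e : c ∣ e
  c∣e = ∣m+n∣m⇒∣n (subst (c ∣_) (trans c*p≡b+e (cong (_+ e) b≡3c)) (m∣m*n p)) (n∣m*n 3)

closing-prime-composite : ∀ {b e d q} → 0 < b → Prime (b + e) → Composite (e + (b + e)) → Prime q →
                          d * q ≡ e + (b + e) → (b + e) + 2 * d ≢ b + 2 * e
closing-prime-composite {b} {e} {d} {q} b>0 pr comp pr′ d*q≡ eq =
  [ cofactor-of-composite≢1 pr′ comp d*q≡ , (λ d≡b+e → <⇒≢ (e<2d d≡b+e) (sym 2d≡e)) ]′
    (prime⇒irreducible pr (∣m+n∣m⇒∣n (subst (d ∣_) d*q≡ (m∣m*n q)) d∣e))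
  where
  2d≡e : 2 * d ≡ e
  2d≡e = +-cancelˡ-≡ (b + e) (2 * d) e (trans eq (solve b e))
    where
    solve : ∀ b e → b + 2 * e ≡ (b + e) + e
    solve = solve-∀
  d∣e : d ∣ e
  d∣e = subst (d ∣_) 2d≡e (n∣m*n 2)
  e<2d : d ≡ b + e → e < 2 * d
  e<2d d≡b+e = subst (λ v → e < 2 * v) (sym d≡b+e)
                 (subst (e <_) (solve b e) (m<n+m e (<-≤-trans b>0 (m≤m+n b (b + e)))))
    where
    solve : ∀ b e → (b + (b + e)) + e ≡ 2 * (b + e)
    solve = solve-∀

closing-composite-composite : ∀ {b e c d p q} → 0 < b → 3 ≤ p → c * p ≡ b + e → 3 ≤ q → d * q ≡ e + c →
                              c + 2 * d ≢ b + 2 * e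
closing-composite-composite {suc b} {e} {c} {d} _ p≥3 c*p≡ q≥3 d*q≡ eq = <-irrefl refl (begin-strict
  9 * (B + 2 * e)                         ≡⟨ cong (9 *_) (sym eq) ⟩
  9 * (c + 2 * d)                         ≡⟨ solve₁ c d ⟩
  3 * (c * 3) + 6 * (d * 3)               ≤⟨ +-monoʳ-≤ (3 * (c * 3)) (*-monoʳ-≤ 6 3d≤e+c) ⟩
  3 * (c * 3) + 6 * (e + c)               ≡⟨ solve₂ c e ⟩
  5 * (c * 3) + 6 * e                     ≤⟨ +-monoˡ-≤ (6 * e) (*-monoʳ-≤ 5 3c≤B+e) ⟩
  5 * (B + e) + 6 * e                     <⟨ m<m+n (5 * (B + e) + 6 * e) z<s ⟩
  5 * (B + e) + 6 * e + (4 * B + 7 * e)   ≡⟨ solve₃ B e ⟩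
  9 * (B + 2 * e)                         ∎)
  where
  open ≤-Reasoning
  B : ℕ
  B = suc b
  3c≤B+e : c * 3 ≤ B + e
  3c≤B+e = subst (c * 3 ≤_) c*p≡ (*-monoʳ-≤ c p≥3)
  3d≤e+c : d * 3 ≤ e + c
  3d≤e+c = subst (d * 3 ≤_) d*q≡ (*-monoʳ-≤ d q≥3)
  solve₁ : ∀ c d → 9 * (c + 2 * d) ≡ 3 * (c * 3) + 6 * (d * 3)
  solve₁ = solve-∀
  solve₂ : ∀ c e → 3 * (c * 3) + 6 * (e + c) ≡ 5 * (c * 3) + 6 * e
  solve₂ = solve-∀
  solve₃ : ∀ b e → 5 * (b + e) + 6 * e + (4 * b + 7 * e) ≡ 9 * (b + 2 * e)
  solve₃ = solve-∀

odd-sum-steps-unbalanced : ∀ {b e c d} → 0 < b → 0 < e → OddSumStep b e c → OddSumStep e c d →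
                           c + 2 * d ≢ b + 2 * e
odd-sum-steps-unbalanced b>0 _ (prime-sum _) (prime-sum _) =
  closing-prime-prime b>0
odd-sum-steps-unbalanced _ e>0 (composite-sum comp pr _ c*p≡) (prime-sum pr′) =
  closing-composite-prime e>0 comp pr c*p≡ pr′
odd-sum-steps-unbalanced {d = d} b>0 _ (prime-sum pr) (composite-sum comp pr′ _ d*q≡) =
  closing-prime-composite {d = d} b>0 pr comp pr′ d*q≡
odd-sum-steps-unbalanced {c = c} {d} b>0 _ (composite-sum _ _ p≥3 c*p≡) (composite-sum _ _ q≥3 d*q≡) =
  closing-composite-composite {c = c} {d} b>0 p≥3 c*p≡ q≥3 d*q≡

averaging-preserves-weight : (v : ℕ → ℕ) (n : ℕ) → (∀ {j} → j < n → v (2 + j) * 2 ≡ v j + v (1 + j)) →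
                             v n + 2 * v (1 + n) ≡ v 0 + 2 * v 1
averaging-preserves-weight v zero    _   = refl
averaging-preserves-weight v (suc n) avg = begin
  v (1 + n) + 2 * v (2 + n)       ≡⟨ cong (v (1 + n) +_) (trans (*-comm 2 (v (2 + n))) (avg ≤-refl)) ⟩
  v (1 + n) + (v n + v (1 + n))   ≡⟨ solve (v n) (v (1 + n)) ⟩
  v n + 2 * v (1 + n)             ≡⟨ averaging-preserves-weight v n (λ j<n → avg (m<n⇒m<1+n j<n)) ⟩
  v 0 + 2 * v 1                   ∎
  where
  open ≡-Reasoning
  solve : ∀ a b → b + (a + b) ≡ a + 2 * b
  solve = solve-∀

record SingleRun (m : ℕ) (u : ℕ → ℕ) : Set where
  field
    periodic : ∀ j → u (j + m) ≡ u j
    positive : ∀ j → 0 < u j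
    rule     : ∀ j → SubprimeStep (u j) (u (1 + j)) (u (2 + j))
    even₀    : 2 ∣ u 0
    odd      : ∀ {j} → 0 < j → j < m → ¬ 2 ∣ u j

module _ {n : ℕ} {u : ℕ → ℕ} (run : SingleRun (2 + n) u) where
  open SingleRun run

  Averages : ℕ → Set
  Averages j = u (3 + j) * 2 ≡ u (1 + j) + u (2 + j)

  odd-before-end : ∀ {j} → j < 1 + n → ¬ 2 ∣ u (1 + j)
  odd-before-end j<1+n = odd z<s (s≤s j<1+n)

  step-in-run : ∀ {j} → j < n → Averages j ⊎ (u (1 + j) ≡ 1 × u (2 + j) ≡ 1 × u (3 + j) ≡ 2)
  step-in-run j<n = subprimeStep-odd-odd (positive _) (positive _)
    (odd-before-end (m<n⇒m<1+n j<n)) (odd-before-end (s≤s j<n)) (rule _)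

  average-before-end : ∀ {j} → 1 + j < n → Averages j
  average-before-end 1+j<n with step-in-run (<-trans (n<1+n _) 1+j<n)
  ... | inj₁ avg          = avg
  ... | inj₂ (_ , _ , u≡2) = contradiction (subst (2 ∣_) (sym u≡2) ∣-refl) (odd-before-end (s≤s 1+j<n))

  weight-along-run : ∀ {k} → (∀ {j} → j < k → Averages j) → u (1 + k) + 2 * u (2 + k) ≡ u 1 + 2 * u 2
  weight-along-run {k} = averaging-preserves-weight (λ j → u (1 + j)) k

  closing-steps-impossible : (∀ {j} → j < n → Averages j) → ⊥
  closing-steps-impossible avg =
    odd-sum-steps-unbalanced (positive _) (positive _) first second balanced
    where
    open ≡-Reasoning
    even-end : 2 ∣ u (2 + n)
    even-end = subst (2 ∣_) (sym (periodic 0)) even₀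
    odd-after-end : ¬ 2 ∣ u (3 + n)
    odd-after-end = subst (λ v → ¬ 2 ∣ v) (sym (periodic 1)) (odd-before-end z<s)
    first : OddSumStep (u (1 + n)) (u (2 + n)) (u (3 + n))
    first = subprimeStep-odd-sum (odd+even (odd-before-end ≤-refl) even-end) (rule _)
    second : OddSumStep (u (2 + n)) (u (3 + n)) (u (4 + n))
    second = subprimeStep-odd-sum (even+odd even-end odd-after-end) (rule _)
    balanced : u (3 + n) + 2 * u (4 + n) ≡ u (1 + n) + 2 * u (2 + n)
    balanced = begin
      u (3 + n) + 2 * u (4 + n)   ≡⟨ cong₂ (λ c d → c + 2 * d) (periodic 1) (periodic 2) ⟩
      u 1 + 2 * u 2               ≡⟨ weight-along-run avg ⟨
      u (1 + n) + 2 * u (2 + n)   ∎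

  -- 1, 1 ↦ 2 forces u₁ + 2u₂ = 3, whereas the following step 1, 2 ↦ u₁ gives u₁ = 3.
  degenerate-end-impossible : ∀ {k} → 1 + k ≡ n → (∀ {j} → j < k → Averages j) →
                              u (1 + k) ≡ 1 → u (2 + k) ≡ 1 → u (3 + k) ≡ 2 → ⊥
  degenerate-end-impossible {k} refl avg u≡1 u′≡1 u≡2 = <⇒≢ (positive 2) (sym u₂≡0)
    where
    u₁≡3 : u 1 ≡ 3
    u₁≡3 = trans (sym (periodic 1))
             (subprimeStep-1-2 (subst₂ (λ y z → SubprimeStep y z (u (4 + k))) u′≡1 u≡2 (rule (2 + k))))
    weight≡3 : 3 + 2 * u 2 ≡ 3 + 0
    weight≡3 = trans (cong (λ v → v + 2 * u 2) (sym u₁≡3))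
                 (trans (sym (weight-along-run avg)) (cong₂ (λ a b → a + 2 * b) u≡1 u′≡1))
    u₂≡0 : u 2 ≡ 0
    u₂≡0 = m+n≡0⇒m≡0 (u 2) (+-cancelˡ-≡ 3 (2 * u 2) 0 weight≡3)

singleRun-impossible : ∀ {m u} → 2 ≤ m → ¬ SingleRun m u
singleRun-impossible {1} (s≤s ())
singleRun-impossible {2} _ run = closing-steps-impossible run (λ ())
singleRun-impossible {suc (suc (suc n))} _ run with step-in-run run (n<1+n n)
... | inj₁ last = closing-steps-impossible run averages
  where
  averages : ∀ {j} → j < 1 + n → Averages run j
  averages j<1+n with m≤n⇒m<n∨m≡n j<1+n
  ... | inj₁ 1+j<1+n = average-before-end run 1+j<1+n
  ... | inj₂ refl    = last
... | inj₂ (u≡1 , u′≡1 , u≡2) =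
  degenerate-end-impossible run refl (average-before-end run ∘′ s≤s) u≡1 u′≡1 u≡2

nontrivialCycle-length≥2 : ∀ {m t} → NontrivialCycle m t → 2 ≤ m
nontrivialCycle-length≥2 {0} cycle = contradiction (NontrivialCycle.length-pos cycle) n≮0
nontrivialCycle-length≥2 {1} {t} cycle with NontrivialCycle.notConst cycle
... | i , j , tᵢ≢tⱼ = contradiction (trans (constant i) (sym (constant j))) tᵢ≢tⱼ
  where
  constant : ∀ i → t i ≡ t 0
  constant zero    = refl
  constant (suc i) = trans (cong t (+-comm 1 i)) (trans (NontrivialCycle.periodic cycle i) (constant i))
nontrivialCycle-length≥2 {suc (suc _)} _ = s≤s (s≤s z≤n)

singleRun-from-even : ∀ {m t k} → NontrivialCycle m t → k < m → 2 ∣ t k → (∀ j → j < m → j ≢ k → ¬ 2 ∣ t j) →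
                      SingleRun m (λ j → t (j + k))
singleRun-from-even {m} {t} {k} cycle k<m 2∣tₖ others-odd = record
  { periodic = λ j → trans (cong t (shift j)) (periodic (j + k))
  ; positive = λ j → positive (j + k)
  ; rule     = λ j → rule (j + k)
  ; even₀    = 2∣tₖ
  ; odd      = odd-after
  }
  where
  open NontrivialCycle cycle
  shift : ∀ j → j + m + k ≡ j + k + m
  shift j = solve j m k
    where
    solve : ∀ j m k → j + m + k ≡ j + k + m
    solve = solve-∀
  odd-after : ∀ {j} → 0 < j → j < m → ¬ 2 ∣ t (j + k)
  odd-after {j} j>0 j<m with j + k <? m
  ... | yes j+k<m = others-odd (j + k) j+k<m (<⇒≢ (m<n+m k j>0) ∘ sym)
  ... | no j+k≮m  = λ 2∣ → others-odd i (<-trans i<k k<m) (<⇒≢ i<k)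
                              (subst (2 ∣_) (trans (cong t (sym i+m≡j+k)) (periodic i)) 2∣)
    where
    i : ℕ
    i = j + k ∸ m
    i+m≡j+k : i + m ≡ j + k
    i+m≡j+k = m∸n+n≡m (≮⇒≥ j+k≮m)
    i<k : i < k
    i<k = +-cancelʳ-< m i k (subst (_< k + m) (sym (trans i+m≡j+k (+-comm j k))) (+-monoʳ-< k j<m))

theorem6 : ∀ (m : ℕ) (t : ℕ → ℕ) → ¬ (NontrivialCycle m t × ExactlyOneEven m t)
theorem6 m t (cycle , k , k<m , 2∣tₖ , others-odd) =
  singleRun-impossible (nontrivialCycle-length≥2 cycle) (singleRun-from-even cycle k<m 2∣tₖ others-odd)
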